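{- Let $k\ge1$ be an integer and let $x_0,x_1,\ldots,x_{k+1}\in\mathbb{Z}$ be pairwise distinct. Then there are infinitely many polynomials $f\in\mathbb{Z}[x]$ with $\deg f=k$ such that $\{x_i:0\le i\le k+1\}$ is an $(F_f,2)$-Diophantine set, where $F_f(x,y)=f(x)f(y)$.
   Context: For $F\in\mathbb{Z}[x,y]$ and an integer $m\ge 2$, a set $A\subset\mathbb{Z}$ is called an $(F,m)$-Diophantine set if $F(a,b)$ is a perfect $m$-th power (of an integer) for all $a,b\in A$ with $a\neq b$. -}

module Defs where

open import Data.Nat using (ℕ; zero; suc)
open import Data.Integer using (ℤ; _+_; _*_; _^_; 0ℤ)
open import Data.Fin using (Fin)
open import Data.Vec using (Vec; []; _∷_; last)
open import Data.Product using (∃)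
open import Relation.Binary.PropositionalEquality using (_≡_; _≢_)

-- A polynomial in ℤ[x] of degree (at most) d is represented by its
-- coefficient vector [a₀, a₁, …, a_d] (constant term first).
Poly : ℕ → Set
Poly d = Vec ℤ (suc d)

eval : ∀ {d} → Poly d → ℤ → ℤ
eval {zero}  (a ∷ [])         x = a
eval {suc d} (a ∷ as@(_ ∷ _)) x = a + x * eval {d} as x

HasDegree : ∀ d → Poly d → Set
HasDegree d f = last f ≢ 0ℤ

IsPerfectPower : ℕ → ℤ → Set
IsPerfectPower m n = ∃ λ (z : ℤ) → n ≡ z ^ m

IsDiophantineSet : (ℤ → ℤ → ℤ) → ℕ → ∀ {n} → (Fin n → ℤ) → Set
IsDiophantineSet F m {n} x =
  (i j : Fin n) → x i ≢ x j → IsPerfectPower m (F (x i) (x j))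

Ff : ∀ {d} → Poly d → ℤ → ℤ → ℤ
Ff f a b = eval f a * eval f b

module Submission where

-- Let N(y) = (y − x₂)⋯(y − x_{k+1}) be the monic polynomial of
-- degree k vanishing at x₂,…,x_{k+1}, and put A = N(x₀), B = N(x₁); A is
-- nonzero since the points are distinct.  For f = U² + c·N the values at
-- x₂,…,x_{k+1} are U², and the two-squares identity below chooses U and c
-- (depending on a free integer parameter b) so that f(x₀) = U² + cA and
-- f(x₁) = U² + cB are squares as well.  Then every value f(xᵢ) is a square,
-- so every product f(xᵢ)f(xⱼ) is a square.  The leading coefficient of f is c,
-- and for b = 2At the integer c is a nonzero multiple of t; taking t larger
-- than the sum of the leading coefficients of the polynomials in a given
-- list L makes f of exact degree k and different from everything in L.

open import Defs
open import Data.Nat using (ℕ; suc; _≥_)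
open import Data.Integer using (ℤ)
open import Data.Fin using (Fin)
open import Data.List using (List)
open import Data.List.Membership.Propositional using (_∉_)
open import Data.Product using (∃; _×_)
open import Function.Definitions using (Injective)
open import Relation.Binary.PropositionalEquality using (_≡_)

import Data.Nat as ℕ
import Data.Nat.Properties as ℕ
open import Data.Nat using (zero; _<_; _≤_; ≢-nonZero)
open import Data.Integer using (+_; _+_; _*_; _-_; -_; 0ℤ; 1ℤ; ∣_∣)
open import Data.Integer.Properties using (i*j≡0⇒i≡0∨j≡0; abs-*; ∣i∣≡0⇒i≡0; i-j≡0⇒i≡j; +-assoc; *-identityʳ)
open import Data.Integer.Tactic.RingSolver using (solve-∀)
open import Data.Fin using (zero; suc)
open import Data.Vec using ([]; _∷_; last; map)
open import Data.List using ([]; _∷_)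
open import Data.List.Membership.Propositional using (_∈_)
open import Data.List.Relation.Unary.Any using (here; there)
open import Data.Product using (_,_)
open import Data.Sum using (inj₁; inj₂)
open import Relation.Binary.PropositionalEquality using (_≢_; refl; sym; trans; cong; cong₂; module ≡-Reasoning)

-- Evaluation of a polynomial with at least two coefficients unfolds one
-- Horner step; `eval` itself only reduces once the tail is a visible cons.
eval-cons : ∀ {d} a (p : Poly d) y → eval (a ∷ p) y ≡ a + y * eval p y
eval-cons a (_ ∷ _) y = refl

shift : ∀ {d} → ℤ → Poly d → Poly d
shift u (a ∷ p) = (u + a) ∷ p

eval-shift : ∀ {d} u (p : Poly d) y → eval (shift u p) y ≡ u + eval p y
eval-shift {zero}  u (a ∷ []) y = refl
eval-shift {suc d} u (a ∷ p)  y = begin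
  eval ((u + a) ∷ p) y    ≡⟨ eval-cons (u + a) p y ⟩
  (u + a) + y * eval p y  ≡⟨ +-assoc u a (y * eval p y) ⟩
  u + (a + y * eval p y)  ≡⟨ cong (λ v → u + v) (sym (eval-cons a p y)) ⟩
  u + eval (a ∷ p) y      ∎
  where open ≡-Reasoning

last-shift : ∀ {d} u (p : Poly (suc d)) → last (shift u p) ≡ last p
last-shift u (a ∷ p) = refl

scale : ∀ {d} → ℤ → Poly d → Poly d
scale c p = map (c *_) p

eval-scale : ∀ {d} c (p : Poly d) y → eval (scale c p) y ≡ c * eval p y
eval-scale {zero}  c (a ∷ []) y = refl
eval-scale {suc d} c (a ∷ p)  y = begin
  eval (c * a ∷ scale c p) y          ≡⟨ eval-cons (c * a) (scale c p) y ⟩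
  c * a + y * eval (scale c p) y      ≡⟨ cong (λ v → c * a + y * v) (eval-scale c p y) ⟩
  c * a + y * (c * eval p y)          ≡⟨ distribute c a y (eval p y) ⟩
  c * (a + y * eval p y)              ≡⟨ cong (c *_) (sym (eval-cons a p y)) ⟩
  c * eval (a ∷ p) y                  ∎
  where
  open ≡-Reasoning
  distribute : ∀ c a y e → c * a + y * (c * e) ≡ c * (a + y * e)
  distribute = solve-∀

last-scale : ∀ {d} c (p : Poly d) → last (scale c p) ≡ c * last p
last-scale {zero}  c (a ∷ []) = refl
last-scale {suc d} c (a ∷ p)  = last-scale c p

mulLinear : ∀ {d} → ℤ → Poly d → Poly (suc d)
mulLinear {zero}  r (a ∷ []) = - r * a ∷ a ∷ []
mulLinear {suc d} r (a ∷ p)  = - r * a ∷ shift a (mulLinear r p)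

eval-mulLinear : ∀ {d} r (p : Poly d) y → eval (mulLinear r p) y ≡ (y - r) * eval p y
eval-mulLinear {zero}  r (a ∷ []) y = linear r a y
  where
  linear : ∀ r a y → - r * a + y * a ≡ (y - r) * a
  linear = solve-∀
eval-mulLinear {suc d} r (a ∷ p)  y = begin
  eval (- r * a ∷ shift a (mulLinear r p)) y       ≡⟨ eval-cons (- r * a) (shift a (mulLinear r p)) y ⟩
  - r * a + y * eval (shift a (mulLinear r p)) y   ≡⟨ cong (λ v → - r * a + y * v) (eval-shift a (mulLinear r p) y) ⟩
  - r * a + y * (a + eval (mulLinear r p) y)       ≡⟨ cong (λ v → - r * a + y * (a + v)) (eval-mulLinear r p y) ⟩
  - r * a + y * (a + (y - r) * eval p y)           ≡⟨ horner r a y (eval p y) ⟩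
  (y - r) * (a + y * eval p y)                     ≡⟨ cong ((y - r) *_) (sym (eval-cons a p y)) ⟩
  (y - r) * eval (a ∷ p) y                         ∎
  where
  open ≡-Reasoning
  horner : ∀ r a y e → - r * a + y * (a + (y - r) * e) ≡ (y - r) * (a + y * e)
  horner = solve-∀

last-mulLinear : ∀ {d} r (p : Poly d) → last (mulLinear r p) ≡ last p
last-mulLinear {zero}  r (a ∷ []) = refl
last-mulLinear {suc d} r (a ∷ p)  = trans (last-shift a (mulLinear r p)) (last-mulLinear r p)

*-≢0 : ∀ i j → i ≢ 0ℤ → j ≢ 0ℤ → i * j ≢ 0ℤ
*-≢0 i j i≢0 j≢0 ij≡0 with i*j≡0⇒i≡0∨j≡0 i ij≡0
... | inj₁ i≡0 = i≢0 i≡0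
... | inj₂ j≡0 = j≢0 j≡0

-- Odd integers are nonzero: 2m + 1 = 0 would give 2·∣m∣ = 1 in ℕ.
odd≢0 : ∀ m → + 2 * m + 1ℤ ≢ 0ℤ
odd≢0 m odd≡0 = ℕ.even≢odd ∣ - m ∣ 0 (trans (sym (abs-* (+ 2) (- m))) (cong ∣_∣ twice-neg≡1))
  where
  rearrange : ∀ m → + 2 * (- m) ≡ 1ℤ - (+ 2 * m + 1ℤ)
  rearrange = solve-∀
  twice-neg≡1 : + 2 * (- m) ≡ 1ℤ
  twice-neg≡1 = trans (rearrange m) (cong (λ v → 1ℤ - v) odd≡0)

∣i∣≤∣i*j∣ : ∀ i {j} → j ≢ 0ℤ → ∣ i ∣ ≤ ∣ i * j ∣
∣i∣≤∣i*j∣ i {j} j≢0 rewrite abs-* i j =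
  ℕ.m≤m*n ∣ i ∣ ∣ j ∣ {{≢-nonZero (λ ∣j∣≡0 → j≢0 (∣i∣≡0⇒i≡0 ∣j∣≡0))}}

vanishing : (n : ℕ) → (Fin n → ℤ) → Poly n
vanishing zero    r = 1ℤ ∷ []
vanishing (suc n) r = mulLinear (r zero) (vanishing n (λ i → r (suc i)))

vanishing-monic : ∀ n r → last (vanishing n r) ≡ 1ℤ
vanishing-monic zero    r = refl
vanishing-monic (suc n) r =
  trans (last-mulLinear (r zero) (vanishing n (λ i → r (suc i))))
        (vanishing-monic n (λ i → r (suc i)))

vanishing-root : ∀ n r i → eval (vanishing n r) (r i) ≡ 0ℤ
vanishing-root (suc n) r i = begin
  eval (vanishing (suc n) r) (r i)                    ≡⟨ eval-mulLinear (r zero) rest (r i) ⟩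
  (r i - r zero) * eval rest (r i)                    ≡⟨ factor-vanishes i ⟩
  0ℤ                                                  ∎
  where
  open ≡-Reasoning
  rest : Poly n
  rest = vanishing n (λ j → r (suc j))
  factor-vanishes : ∀ i → (r i - r zero) * eval rest (r i) ≡ 0ℤ
  factor-vanishes zero    = self-difference (r zero) (eval rest (r zero))
    where
    self-difference : ∀ a e → (a - a) * e ≡ 0ℤ
    self-difference = solve-∀
  factor-vanishes (suc i) =
    trans (cong ((r (suc i) - r zero) *_) (vanishing-root n (λ j → r (suc j)) i))
          (times-zero (r (suc i) - r zero))
    where
    times-zero : ∀ a → a * 0ℤ ≡ 0ℤ
    times-zero = solve-∀

vanishing-nonzero : ∀ n r y → (∀ i → y ≢ r i) → eval (vanishing n r) y ≢ 0ℤ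
vanishing-nonzero zero    r y y∉r ()
vanishing-nonzero (suc n) r y y∉r value≡0 =
  *-≢0 (y - r zero) _ (λ diff≡0 → y∉r zero (i-j≡0⇒i≡j y (r zero) diff≡0))
       (vanishing-nonzero n (λ i → r (suc i)) y (λ i → y∉r (suc i)))
       (trans (sym (eval-mulLinear (r zero) (vanishing n (λ i → r (suc i))) y)) value≡0)

module TwoSquares (A B b : ℤ) where

  a w U c : ℤ
  a = b + 1ℤ
  w = B * b - A * a
  U = B * b * b - A * a * a
  c = + 4 * (a * b * w)

  square-at-A : U * U + c * A ≡ (U + + 2 * A * a) * (U + + 2 * A * a)
  square-at-A = identity A B b
    where
    identity : ∀ A B b → let a = b + 1ℤ ; U = B * b * b - A * a * a in
      U * U + + 4 * (a * b * (B * b - A * a)) * A ≡ (U + + 2 * A * a) * (U + + 2 * A * a)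
    identity = solve-∀

  square-at-B : U * U + c * B ≡ (U + + 2 * B * b) * (U + + 2 * B * b)
  square-at-B = identity A B b
    where
    identity : ∀ A B b → let a = b + 1ℤ ; U = B * b * b - A * a * a in
      U * U + + 4 * (a * b * (B * b - A * a)) * B ≡ (U + + 2 * B * b) * (U + + 2 * B * b)
    identity = solve-∀

IsSquare : ℤ → Set
IsSquare n = ∃ λ z → n ≡ z * z

module SquareValued {d} (N : Poly (suc d)) (y₀ y₁ b : ℤ) where

  open TwoSquares (eval N y₀) (eval N y₁) b public

  f : Poly (suc d)
  f = shift (U * U) (scale c N)

  value : ∀ y → eval f y ≡ U * U + c * eval N y
  value y = trans (eval-shift (U * U) (scale c N) y) (cong (λ v → U * U + v) (eval-scale c N y))

  square-at-y₀ : IsSquare (eval f y₀)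
  square-at-y₀ = U + + 2 * eval N y₀ * a , trans (value y₀) square-at-A

  square-at-y₁ : IsSquare (eval f y₁)
  square-at-y₁ = U + + 2 * eval N y₁ * b , trans (value y₁) square-at-B

  square-at-root : ∀ {y} → eval N y ≡ 0ℤ → IsSquare (eval f y)
  square-at-root {y} root = U , (begin
    eval f y                ≡⟨ value y ⟩
    U * U + c * eval N y    ≡⟨ cong (λ v → U * U + c * v) root ⟩
    U * U + c * 0ℤ          ≡⟨ drop-zero (U * U) c ⟩
    U * U                   ∎)
    where
    open ≡-Reasoning
    drop-zero : ∀ u c → u + c * 0ℤ ≡ u
    drop-zero = solve-∀

  lead-monic : last N ≡ 1ℤ → last f ≡ c
  lead-monic monic = begin
    last f           ≡⟨ last-shift (U * U) (scale c N) ⟩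
    last (scale c N) ≡⟨ last-scale c N ⟩
    c * last N       ≡⟨ cong (c *_) monic ⟩
    c * 1ℤ           ≡⟨ *-identityʳ c ⟩
    c                ∎
    where open ≡-Reasoning

-- For b = 2At with A ≠ 0 and t = n + 1, the scale c is a nonzero multiple of t:
-- a = 2At + 1 is odd, Bb − Aa = A(2(B − A)t − 1) is A times an odd number,
-- and c = t · 8Aa(Bb − Aa).
twoSquares-scale-large : ∀ A B n → A ≢ 0ℤ →
  suc n ≤ ∣ TwoSquares.c A B (+ 2 * A * + suc n) ∣
twoSquares-scale-large A B n A≢0 = begin
  suc n                       ≤⟨ ∣i∣≤∣i*j∣ t cofactor≢0 ⟩
  ∣ t * (+ 8 * A * a * w) ∣   ≡⟨ cong ∣_∣ (sym (c≡t*cofactor A B t)) ⟩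
  ∣ c ∣                       ∎
  where
  open ℕ.≤-Reasoning
  t : ℤ
  t = + suc n
  open TwoSquares A B (+ 2 * A * t)

  a-odd : ∀ A t → + 2 * A * t + 1ℤ ≡ + 2 * (A * t) + 1ℤ
  a-odd = solve-∀
  w-factor : ∀ A B t → B * (+ 2 * A * t) - A * (+ 2 * A * t + 1ℤ) ≡ A * (+ 2 * ((B - A) * t - 1ℤ) + 1ℤ)
  w-factor = solve-∀
  c≡t*cofactor : ∀ A B t → let b = + 2 * A * t ; a = b + 1ℤ ; w = B * b - A * a in
    + 4 * (a * b * w) ≡ t * (+ 8 * A * a * w)
  c≡t*cofactor = solve-∀

  a≢0 : a ≢ 0ℤ
  a≢0 a≡0 = odd≢0 (A * t) (trans (sym (a-odd A t)) a≡0)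
  w≢0 : w ≢ 0ℤ
  w≢0 w≡0 = *-≢0 A _ A≢0 (odd≢0 ((B - A) * t - 1ℤ)) (trans (sym (w-factor A B t)) w≡0)
  cofactor≢0 : + 8 * A * a * w ≢ 0ℤ
  cofactor≢0 = *-≢0 (+ 8 * A * a) w (*-≢0 (+ 8 * A) a (*-≢0 (+ 8) A (λ ()) A≢0) a≢0) w≢0

squareValues⇒Diophantine : ∀ {d n} (f : Poly d) (x : Fin n → ℤ) →
  (∀ i → IsSquare (eval f (x i))) → IsDiophantineSet (Ff f) 2 x
squareValues⇒Diophantine f x square i j _
  with square i | square j
... | p , fxᵢ≡p² | q , fxⱼ≡q² =
  p * q , trans (cong₂ _*_ fxᵢ≡p² fxⱼ≡q²) (product-of-squares p q)
  where
  -- (p q)² unfolds to (p q) * ((p q) * 1) by the definition of _^_.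
  product-of-squares : ∀ p q → (p * p) * (q * q) ≡ (p * q) * ((p * q) * 1ℤ)
  product-of-squares = solve-∀

leadSum : ∀ {d} → List (Poly d) → ℕ
leadSum []      = 0
leadSum (g ∷ L) = ∣ last g ∣ ℕ.+ leadSum L

lead≤leadSum : ∀ {d} {g : Poly d} (L : List (Poly d)) → g ∈ L → ∣ last g ∣ ≤ leadSum L
lead≤leadSum (h ∷ L) (here refl) = ℕ.m≤m+n _ _
lead≤leadSum (h ∷ L) (there g∈L) = ℕ.≤-trans (lead≤leadSum L g∈L) (ℕ.m≤n+m _ _)

large-lead⇒fresh : ∀ {d} (f : Poly d) (L : List (Poly d)) → leadSum L < ∣ last f ∣ → f ∉ L
large-lead⇒fresh f L large f∈L = ℕ.<⇒≱ large (lead≤leadSum L f∈L)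

large-lead⇒degree : ∀ {d} (f : Poly d) → 0 < ∣ last f ∣ → HasDegree d f
large-lead⇒degree f positive last≡0 = ℕ.<⇒≢ positive (sym (cong ∣_∣ last≡0))

corollary4p2 : (k : ℕ) → k ≥ 1 → (x : Fin (suc (suc k)) → ℤ) → Injective _≡_ _≡_ x →
    (L : List (Poly k)) →
    ∃ λ (f : Poly k) → f ∉ L × HasDegree k f × IsDiophantineSet (Ff f) 2 x
-- The case k = 0 is excluded by k ≥ 1; positive degree is what lets the
-- constant U² leave the leading coefficient c of f untouched.
corollary4p2 (suc k) _ x x-inj L =
  f , large-lead⇒fresh f L large , large-lead⇒degree f (ℕ.≤-<-trans ℕ.z≤n large) ,
  squareValues⇒Diophantine f x square-value
  where
  roots : Fin (suc k) → ℤ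
  roots i = x (suc (suc i))
  N : Poly (suc k)
  N = vanishing (suc k) roots
  open SquareValued N (x zero) (x (suc zero)) (+ 2 * eval N (x zero) * + suc (leadSum L))

  square-value : ∀ i → IsSquare (eval f (x i))
  square-value zero          = square-at-y₀
  square-value (suc zero)    = square-at-y₁
  square-value (suc (suc i)) = square-at-root (vanishing-root (suc k) roots i)

  N[x₀]≢0 : eval N (x zero) ≢ 0ℤ
  N[x₀]≢0 = vanishing-nonzero (suc k) roots (x zero) (λ i x₀≡xᵢ → zero≢suc (x-inj x₀≡xᵢ))
    where
    zero≢suc : ∀ {n} {i : Fin (suc n)} → zero ≢ suc i
    zero≢suc ()

  large : leadSum L < ∣ last f ∣
  large rewrite lead-monic (vanishing-monic (suc k) roots) =
    twoSquares-scale-large (eval N (x zero)) (eval N (x (suc zero))) (leadSum L) N[x₀]≢0
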